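{- For every W-logic $\mathsf{WL}$ and every propositional variable $p$: $\mathsf{WL}\not\vdash p\lor\neg p$ and $\mathsf{WL}\not\vdash\Box p\lor\Diamond\neg p$.
   Context: The language $\mathcal{L}$ consists of the formulas built from a countable set of propositional variables by $A ::= p \mid \bot \mid A\land A \mid A\lor A \mid A\to A \mid \Box A \mid \Diamond A$; $\top := \bot\to\bot$, $\neg A := A\to\bot$. Axiom schemes and rules (for all $A,B$): (Mon$_\Box$) from $A\to B$ infer $\Box A\to\Box B$; (Mon$_\Diamond$) from $A\to B$ infer $\Diamond A\to\Diamond B$; (C$_\Box$) $\Box A\land\Box B\to\Box(A\land B)$; (K$_\Diamond$) $\Box(A\to B)\to(\Diamond A\to\Diamond B)$; (N$_\Box$) $\Box\top$; (T$_\Box$) $\Box A\to A$; (T$_\Diamond$) $A\to\Diamond A$; (D) $\Box A\to\Diamond A$; (P$_\Diamond$) $\Diamond\top$; (Dual$_\land$) $\neg(\Box A\land\Diamond\neg A)$. The W-logics are obtained by adding to an axiomatisation of intuitionistic propositional logic (all $\mathcal L$-instances, with modus ponens): $\mathsf{WM}$ := Dual$_\land$ + Mon$_\Box$ + Mon$_\Diamond$; $\mathsf{WMN}$ := $\mathsf{WM}$+N$_\Box$; $\mathsf{WMC}$ := $\mathsf{WM}$+C$_\Box$+K$_\Diamond$; $\mathsf{WK}$ := $\mathsf{WMC}$+N$_\Box$; $\mathsf{WMP}$ := $\mathsf{WM}$+P$_\Diamond$; $\mathsf{WMNP}$ := $\mathsf{WMN}$+P$_\Diamond$; $\mathsf{WMD}$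 := $\mathsf{WM}$+D+P$_\Diamond$; $\mathsf{WMND}$ := $\mathsf{WMN}$+D; $\mathsf{WMCD}$ := $\mathsf{WMC}$+D+P$_\Diamond$; $\mathsf{WKD}$ := $\mathsf{WK}$+D; $\mathsf{WMT}$, $\mathsf{WMNT}$, $\mathsf{WMCT}$, $\mathsf{WKT}$ := respectively $\mathsf{WM}$, $\mathsf{WMN}$, $\mathsf{WMC}$, $\mathsf{WK}$ + T$_\Box$ + T$_\Diamond$. $\mathsf{WL}\vdash A$ means $A$ is derivable from axiom instances of $\mathsf{WL}$ by modus ponens and the rules of $\mathsf{WL}$. -}

module Defs where

open import Data.Nat using (ℕ)
open import Data.Bool using (Bool; true; false)
open import Data.Empty using (⊥)
open import Data.Unit using (⊤)

infixr 6 _∧_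
infixr 5 _∨_
infixr 4 _⇒_
data Fm : Set where
  var : ℕ → Fm
  ⊥'  : Fm
  _∧_ : Fm → Fm → Fm
  _∨_ : Fm → Fm → Fm
  _⇒_ : Fm → Fm → Fm
  □   : Fm → Fm
  ◇   : Fm → Fm

⊤' : Fm
⊤' = ⊥' ⇒ ⊥'

¬' : Fm → Fm
¬' A = A ⇒ ⊥'

data WLogic : Set where
  WM WMN WMC WK WMP WMNP WMD WMND WMCD WKD WMT WMNT WMCT WKT : WLogic

hasN : WLogic → Bool
hasN WMN  = true
hasN WK   = true
hasN WMNP = true
hasN WMND = true
hasN WKD  = true
hasN WMNT = true
hasN WKT  = true
hasN _    = false

-- C_□ and K_◇ (always added together)
hasC : WLogic → Bool
hasC WMC  = true
hasC WK   = true
hasC WMCD = true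
hasC WKD  = true
hasC WMCT = true
hasC WKT  = true
hasC _    = false

hasP : WLogic → Bool
hasP WMP  = true
hasP WMNP = true
hasP WMD  = true
hasP WMCD = true
hasP _    = false

hasD : WLogic → Bool
hasD WMD  = true
hasD WMND = true
hasD WMCD = true
hasD WKD  = true
hasD _    = false

hasT : WLogic → Bool
hasT WMT  = true
hasT WMNT = true
hasT WMCT = true
hasT WKT  = true
hasT _    = false

IsTrue : Bool → Set
IsTrue true  = ⊤
IsTrue false = ⊥

infix 2 _⊢_
data _⊢_ (L : WLogic) : Fm → Set where
  ax-K    : ∀ {A B}   → L ⊢ A ⇒ (B ⇒ A)
  ax-S    : ∀ {A B C} → L ⊢ (A ⇒ (B ⇒ C)) ⇒ ((A ⇒ B) ⇒ (A ⇒ C))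
  ax-∧I   : ∀ {A B}   → L ⊢ A ⇒ (B ⇒ (A ∧ B))
  ax-∧E₁  : ∀ {A B}   → L ⊢ (A ∧ B) ⇒ A
  ax-∧E₂  : ∀ {A B}   → L ⊢ (A ∧ B) ⇒ B
  ax-∨I₁  : ∀ {A B}   → L ⊢ A ⇒ (A ∨ B)
  ax-∨I₂  : ∀ {A B}   → L ⊢ B ⇒ (A ∨ B)
  ax-∨E   : ∀ {A B C} → L ⊢ (A ⇒ C) ⇒ ((B ⇒ C) ⇒ ((A ∨ B) ⇒ C))
  ax-⊥E   : ∀ {A}     → L ⊢ ⊥' ⇒ A
  mp      : ∀ {A B}   → L ⊢ A ⇒ B → L ⊢ A → L ⊢ B
  dual∧   : ∀ {A}   → L ⊢ ¬' (□ A ∧ ◇ (¬' A))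
  mon□    : ∀ {A B} → L ⊢ A ⇒ B → L ⊢ □ A ⇒ □ B
  mon◇    : ∀ {A B} → L ⊢ A ⇒ B → L ⊢ ◇ A ⇒ ◇ B
  ax-N□   : IsTrue (hasN L) → L ⊢ □ ⊤'
  ax-C□   : ∀ {A B} → IsTrue (hasC L) → L ⊢ (□ A ∧ □ B) ⇒ □ (A ∧ B)
  ax-K◇   : ∀ {A B} → IsTrue (hasC L) → L ⊢ □ (A ⇒ B) ⇒ (◇ A ⇒ ◇ B)
  ax-P◇   : IsTrue (hasP L) → L ⊢ ◇ ⊤'
  ax-D    : ∀ {A} → IsTrue (hasD L) → L ⊢ □ A ⇒ ◇ A
  ax-T□   : ∀ {A} → IsTrue (hasT L) → L ⊢ □ A ⇒ A
  ax-T◇   : ∀ {A} → IsTrue (hasT L) → L ⊢ A ⇒ ◇ A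

module Submission where

-- Read □ and ◇ as the identity: every modal axiom of every W-logic becomes an
-- intuitionistic tautology (Dual∧ turns into ¬(A ∧ ¬A), the others into A ⇒ A
-- or ⊤), so each W-logic is sound for the three-element Heyting chain
-- 0 < ½ < 1.  Valuing p at ½, both p ∨ ¬p and □p ∨ ◇¬p evaluate to ½ ∨ 0 = ½.

open import Defs
open import Data.Nat using (ℕ)
open import Data.Product using (_×_; _,_)
open import Relation.Nullary using (¬_)
open import Relation.Binary.PropositionalEquality using (_≡_; refl)

data Three : Set where
  0̂ ½ 1̂ : Three

infixr 7 _⊓_
infixr 6 _⊔_
infixr 5 _↝_

_⊓_ : Three → Three → Three
0̂ ⊓ _  = 0̂
½ ⊓ 0̂ = 0̂
½ ⊓ _  = ½
1̂ ⊓ b  = b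

_⊔_ : Three → Three → Three
0̂ ⊔ b  = b
½ ⊔ 1̂ = 1̂
½ ⊔ _  = ½
1̂ ⊔ _  = 1̂

_↝_ : Three → Three → Three
0̂ ↝ _  = 1̂
½ ↝ 0̂ = 0̂
½ ↝ _  = 1̂
1̂ ↝ b  = b

↝-refl : ∀ a → a ↝ a ≡ 1̂
↝-refl 0̂ = refl
↝-refl ½ = refl
↝-refl 1̂ = refl

↝-top : ∀ a → a ↝ 1̂ ≡ 1̂
↝-top 0̂ = refl
↝-top ½ = refl
↝-top 1̂ = refl

↝-mp : ∀ a b → a ↝ b ≡ 1̂ → a ≡ 1̂ → b ≡ 1̂
↝-mp 1̂ b ab≡1 refl = ab≡1

↝-K : ∀ a b → a ↝ b ↝ a ≡ 1̂
↝-K 0̂ b = refl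
↝-K ½ 0̂ = refl
↝-K ½ ½ = refl
↝-K ½ 1̂ = refl
↝-K 1̂ b = ↝-top b

↝-S : ∀ a b c → (a ↝ b ↝ c) ↝ (a ↝ b) ↝ a ↝ c ≡ 1̂
↝-S 0̂ b c = refl
↝-S ½ 0̂ c = refl
↝-S ½ ½ 0̂ = refl
↝-S ½ ½ ½ = refl
↝-S ½ ½ 1̂ = refl
↝-S ½ 1̂ 0̂ = refl
↝-S ½ 1̂ ½ = refl
↝-S ½ 1̂ 1̂ = refl
↝-S 1̂ b c = ↝-refl (b ↝ c)

⊓-intro : ∀ a b → a ↝ b ↝ a ⊓ b ≡ 1̂
⊓-intro 0̂ b = refl
⊓-intro ½ 0̂ = refl
⊓-intro ½ ½ = refl
⊓-intro ½ 1̂ = refl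
⊓-intro 1̂ b = ↝-refl b

⊓-elimˡ : ∀ a b → a ⊓ b ↝ a ≡ 1̂
⊓-elimˡ 0̂ b = refl
⊓-elimˡ ½ 0̂ = refl
⊓-elimˡ ½ ½ = refl
⊓-elimˡ ½ 1̂ = refl
⊓-elimˡ 1̂ b = ↝-top b

⊓-elimʳ : ∀ a b → a ⊓ b ↝ b ≡ 1̂
⊓-elimʳ 0̂ b = refl
⊓-elimʳ ½ 0̂ = refl
⊓-elimʳ ½ ½ = refl
⊓-elimʳ ½ 1̂ = refl
⊓-elimʳ 1̂ b = ↝-refl b

⊔-introˡ : ∀ a b → a ↝ a ⊔ b ≡ 1̂
⊔-introˡ 0̂ b = refl
⊔-introˡ ½ 0̂ = refl
⊔-introˡ ½ ½ = refl
⊔-introˡ ½ 1̂ = refl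
⊔-introˡ 1̂ b = refl

⊔-introʳ : ∀ a b → b ↝ a ⊔ b ≡ 1̂
⊔-introʳ 0̂ b = ↝-refl b
⊔-introʳ ½ 0̂ = refl
⊔-introʳ ½ ½ = refl
⊔-introʳ ½ 1̂ = refl
⊔-introʳ 1̂ b = ↝-top b

⊔-elim : ∀ a b c → (a ↝ c) ↝ (b ↝ c) ↝ a ⊔ b ↝ c ≡ 1̂
⊔-elim 0̂ b c = ↝-refl (b ↝ c)
⊔-elim ½ 0̂ 0̂ = refl
⊔-elim ½ 0̂ ½ = refl
⊔-elim ½ 0̂ 1̂ = refl
⊔-elim ½ ½ 0̂ = refl
⊔-elim ½ ½ ½ = refl
⊔-elim ½ ½ 1̂ = refl
⊔-elim ½ 1̂ 0̂ = refl
⊔-elim ½ 1̂ ½ = refl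
⊔-elim ½ 1̂ 1̂ = refl
⊔-elim 1̂ b c = ↝-K c (b ↝ c)

non-contradiction : ∀ a → a ⊓ (a ↝ 0̂) ↝ 0̂ ≡ 1̂
non-contradiction 0̂ = refl
non-contradiction ½ = refl
non-contradiction 1̂ = refl

⟦_⟧ : Fm → (ℕ → Three) → Three
⟦ var n ⟧ ρ = ρ n
⟦ ⊥'    ⟧ ρ = 0̂
⟦ A ∧ B ⟧ ρ = ⟦ A ⟧ ρ ⊓ ⟦ B ⟧ ρ
⟦ A ∨ B ⟧ ρ = ⟦ A ⟧ ρ ⊔ ⟦ B ⟧ ρ
⟦ A ⇒ B ⟧ ρ = ⟦ A ⟧ ρ ↝ ⟦ B ⟧ ρ
⟦ □ A   ⟧ ρ = ⟦ A ⟧ ρ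
⟦ ◇ A   ⟧ ρ = ⟦ A ⟧ ρ

soundness : ∀ {L A} → L ⊢ A → (ρ : ℕ → Three) → ⟦ A ⟧ ρ ≡ 1̂
soundness (ax-K {A} {B})        ρ = ↝-K (⟦ A ⟧ ρ) (⟦ B ⟧ ρ)
soundness (ax-S {A} {B} {C})    ρ = ↝-S (⟦ A ⟧ ρ) (⟦ B ⟧ ρ) (⟦ C ⟧ ρ)
soundness (ax-∧I {A} {B})       ρ = ⊓-intro (⟦ A ⟧ ρ) (⟦ B ⟧ ρ)
soundness (ax-∧E₁ {A} {B})      ρ = ⊓-elimˡ (⟦ A ⟧ ρ) (⟦ B ⟧ ρ)
soundness (ax-∧E₂ {A} {B})      ρ = ⊓-elimʳ (⟦ A ⟧ ρ) (⟦ B ⟧ ρ)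
soundness (ax-∨I₁ {A} {B})      ρ = ⊔-introˡ (⟦ A ⟧ ρ) (⟦ B ⟧ ρ)
soundness (ax-∨I₂ {A} {B})      ρ = ⊔-introʳ (⟦ A ⟧ ρ) (⟦ B ⟧ ρ)
soundness (ax-∨E {A} {B} {C})   ρ = ⊔-elim (⟦ A ⟧ ρ) (⟦ B ⟧ ρ) (⟦ C ⟧ ρ)
soundness ax-⊥E                 ρ = refl
soundness (mp {A} {B} A⇒B ⊢A)   ρ = ↝-mp (⟦ A ⟧ ρ) (⟦ B ⟧ ρ) (soundness A⇒B ρ) (soundness ⊢A ρ)
soundness (dual∧ {A})           ρ = non-contradiction (⟦ A ⟧ ρ)
soundness (mon□ A⇒B)            ρ = soundness A⇒B ρ
soundness (mon◇ A⇒B)            ρ = soundness A⇒B ρ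
soundness (ax-N□ _)             ρ = refl
soundness (ax-C□ {A} {B} _)     ρ = ↝-refl (⟦ A ⟧ ρ ⊓ ⟦ B ⟧ ρ)
soundness (ax-K◇ {A} {B} _)     ρ = ↝-refl (⟦ A ⟧ ρ ↝ ⟦ B ⟧ ρ)
soundness (ax-P◇ _)             ρ = refl
soundness (ax-D {A} _)          ρ = ↝-refl (⟦ A ⟧ ρ)
soundness (ax-T□ {A} _)         ρ = ↝-refl (⟦ A ⟧ ρ)
soundness (ax-T◇ {A} _)         ρ = ↝-refl (⟦ A ⟧ ρ)

½≢1̂ : ¬ (½ ≡ 1̂)
½≢1̂ ()

proposition3p6 : (L : WLogic) (p : ℕ) →
    (¬ (L ⊢ var p ∨ ¬' (var p))) × (¬ (L ⊢ □ (var p) ∨ ◇ (¬' (var p))))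
proposition3p6 L p = (λ ⊢lem → ½≢1̂ (soundness ⊢lem everywhere-½))
                   , (λ ⊢lem□◇ → ½≢1̂ (soundness ⊢lem□◇ everywhere-½))
  where
  everywhere-½ : ℕ → Three
  everywhere-½ _ = ½
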